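{- Let $(A,\sigma)$ be a state BL-algebra, let $F$ be a maximal state-filter of $(A,\sigma)$, and let $a\in A$ be such that $\sigma(a)/F$ is co-infinitesimal in $A/F$, i.e. $((\sigma(a)/F)^n)^-\le\sigma(a)/F$ for every integer $n\ge1$. Then $\sigma(a)\in F$.
   Context: A BL-algebra is an algebra $(A,\wedge,\vee,\odot,\to,0,1)$ of type $(2,2,2,2,0,0)$ such that $(A,\wedge,\vee,0,1)$ is a bounded lattice, $(A,\odot,1)$ is a commutative monoid, and for all $a,b,c\in A$: $c\le a\to b$ iff $a\odot c\le b$; $a\wedge b=a\odot(a\to b)$; $(a\to b)\vee(b\to a)=1$. Write $x^-:=x\to0$ and $x^n=x\odot\cdots\odot x$. A state-operator on $A$ is a map $\sigma:A\to A$ such that for all $x,y\in A$: (1) $\sigma(0)=0$; (2) $\sigma(x\to y)=\sigma(x)\to\sigma(x\wedge y)$; (3) $\sigma(x\odot y)=\sigma(x)\odot\sigma(x\to x\odot y)$; (4) $\sigma(\sigma(x)\odot\sigma(y))=\sigma(x)\odot\sigma(y)$; (5) $\sigma(\sigma(x)\to\sigma(y))=\sigma(x)\to\sigma(y)$. A filter is a nonempty subset closed under $\odot$ and upward closed. A state-filter of $(A,\sigma)$ is a filter $F$ with $\sigma(F)\subseteq F$; a maximal state-filter is a proper state-filter not properly contained in any other proper state-filter. For a filter $F$, $A/F$ is the quotient BL-algebra by the congruence $x\sim_F y$ iff $(x\to y)\odot(y\to x)\in F$, and $x/F$ denotes the class of $x$. -}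

module Defs where

open import Level using (Level; suc; _⊔_)
open import Data.Nat using (ℕ; zero) renaming (suc to sucℕ)
open import Data.Product using (_×_; Σ; ∃)
open import Relation.Binary.PropositionalEquality using (_≡_)
open import Relation.Nullary using (¬_)

record BLAlgebra (a : Level) : Set (suc a) where
  infixr 7 _⊙_
  infixr 5 _⇒_
  infixr 6 _∧_
  infixr 6 _∨_
  field
    Carrier : Set a
    _∧_ _∨_ _⊙_ _⇒_ : Carrier → Carrier → Carrier
    𝟘 𝟙 : Carrier

  _≤_ : Carrier → Carrier → Set a
  x ≤ y = x ∧ y ≡ x

  field
    ∧-comm   : ∀ x y → x ∧ y ≡ y ∧ x
    ∨-comm   : ∀ x y → x ∨ y ≡ y ∨ x
    ∧-assoc  : ∀ x y z → (x ∧ y) ∧ z ≡ x ∧ (y ∧ z)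
    ∨-assoc  : ∀ x y z → (x ∨ y) ∨ z ≡ x ∨ (y ∨ z)
    ∧-absorb : ∀ x y → x ∧ (x ∨ y) ≡ x
    ∨-absorb : ∀ x y → x ∨ (x ∧ y) ≡ x
    𝟘-least  : ∀ x → 𝟘 ≤ x
    𝟙-greatest : ∀ x → x ≤ 𝟙
    ⊙-comm   : ∀ x y → x ⊙ y ≡ y ⊙ x
    ⊙-assoc  : ∀ x y z → (x ⊙ y) ⊙ z ≡ x ⊙ (y ⊙ z)
    ⊙-identityʳ : ∀ x → x ⊙ 𝟙 ≡ x
    residuation₁ : ∀ a b c → c ≤ (a ⇒ b) → (a ⊙ c) ≤ b
    residuation₂ : ∀ a b c → (a ⊙ c) ≤ b → c ≤ (a ⇒ b)
    divisibility : ∀ a b → a ∧ b ≡ a ⊙ (a ⇒ b)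
    prelinearity : ∀ a b → (a ⇒ b) ∨ (b ⇒ a) ≡ 𝟙

  _⁻ : Carrier → Carrier
  x ⁻ = x ⇒ 𝟘

  _^_ : Carrier → ℕ → Carrier
  x ^ zero = 𝟙
  x ^ sucℕ n = x ⊙ (x ^ n)

module _ {a : Level} (A : BLAlgebra a) where
  open BLAlgebra A

  record IsStateOperator (σ : Carrier → Carrier) : Set a where
    field
      σ-zero : σ 𝟘 ≡ 𝟘
      σ-⇒    : ∀ x y → σ (x ⇒ y) ≡ σ x ⇒ σ (x ∧ y)
      σ-⊙    : ∀ x y → σ (x ⊙ y) ≡ σ x ⊙ σ (x ⇒ x ⊙ y)
      σ-σ⊙   : ∀ x y → σ (σ x ⊙ σ y) ≡ σ x ⊙ σ y
      σ-σ⇒   : ∀ x y → σ (σ x ⇒ σ y) ≡ σ x ⇒ σ y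

  Subset : (ℓ : Level) → Set (a ⊔ suc ℓ)
  Subset ℓ = Carrier → Set ℓ

  record IsFilter {ℓ} (F : Subset ℓ) : Set (a ⊔ ℓ) where
    field
      nonempty : ∃ λ x → F x
      ⊙-closed : ∀ {x y} → F x → F y → F (x ⊙ y)
      up-closed : ∀ {x y} → F x → x ≤ y → F y

  IsProper : ∀ {ℓ} → Subset ℓ → Set (a ⊔ ℓ)
  IsProper F = Σ Carrier λ x → ¬ F x

  record IsStateFilter {ℓ} (σ : Carrier → Carrier) (F : Subset ℓ) : Set (a ⊔ ℓ) where
    field
      isFilter : IsFilter F
      σ-closed : ∀ {x} → F x → F (σ x)

  -- maximal state-filter: proper state-filter not properly contained in any
  -- other proper state-filter (quantifying over filters of the same level ℓ)
  record IsMaximalStateFilter {ℓ} (σ : Carrier → Carrier) (F : Subset ℓ) : Set (a ⊔ suc ℓ) where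
    field
      isStateFilter : IsStateFilter σ F
      proper : IsProper F
      maximal : ∀ (G : Subset ℓ) → IsStateFilter σ G → IsProper G →
                (∀ {x} → F x → G x) → ∀ {x} → G x → F x

  -- congruence x ~_F y iff (x ⇒ y) ⊙ (y ⇒ x) ∈ F; x/F = y/F iff x ~_F y
  _~[_]_ : ∀ {ℓ} → Carrier → Subset ℓ → Carrier → Set ℓ
  x ~[ F ] y = F ((x ⇒ y) ⊙ (y ⇒ x))

  -- order of A/F on classes: x/F ≤ y/F iff (x/F) ∧ (y/F) = x/F iff (x ∧ y) ~_F x
  _≤[_]_ : ∀ {ℓ} → Carrier → Subset ℓ → Carrier → Set ℓ
  x ≤[ F ] y = (x ∧ y) ~[ F ] x

  -- x/F is co-infinitesimal in A/F: ((x/F)^n)⁻ ≤ x/F for all n ≥ 1.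
  -- Operations on A/F are computed on representatives: (x/F)^n = x^n/F, (y/F)⁻ = y⁻/F.
  CoInfinitesimalMod : ∀ {ℓ} → Subset ℓ → Carrier → Set ℓ
  CoInfinitesimalMod F x = ∀ (n : ℕ) → ((x ^ sucℕ n) ⁻) ≤[ F ] x

-- Adjoining s := σ(x) to F gives the filter ⟨F , s⟩ of all y with s ^ n ⇒ y ∈ F for some n.
-- Since s is a fixed point of σ, so are its powers, which makes ⟨F , s⟩ again a state-filter.
-- It is proper: 𝟘 ∈ ⟨F , s⟩ means (s ^ n)⁻ ∈ F, and co-infinitesimality of s modulo F then
-- puts s, hence s ^ n, hence 𝟘 into F. Maximality of F forces ⟨F , s⟩ ⊆ F, so s ∈ F.
module Submission where

open import Defs
open import Level using (Level)
open import Algebra.Bundles using (CommutativeSemigroup)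
open import Data.Nat using (zero; _+_) renaming (suc to sucℕ)
open import Data.Product using (∃; _,_; proj₁; proj₂)
open import Relation.Binary.PropositionalEquality
  using (_≡_; sym; trans; cong; subst; subst₂; cong₂; isEquivalence; module ≡-Reasoning)
open import Relation.Nullary using (¬_)

module BLProperties {a : Level} (A : BLAlgebra a) where
  open BLAlgebra A

  ∧-idem : ∀ x → x ∧ x ≡ x
  ∧-idem x = trans (cong (x ∧_) (sym (∨-absorb x x))) (∧-absorb x (x ∧ x))

  ≤-refl : ∀ x → x ≤ x
  ≤-refl = ∧-idem

  ≤-trans : ∀ {x y z} → x ≤ y → y ≤ z → x ≤ z
  ≤-trans {x} {y} {z} x≤y y≤z = begin
    x ∧ z        ≡⟨ cong (_∧ z) (sym x≤y) ⟩
    (x ∧ y) ∧ z  ≡⟨ ∧-assoc x y z ⟩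
    x ∧ (y ∧ z)  ≡⟨ cong (x ∧_) y≤z ⟩
    x ∧ y        ≡⟨ x≤y ⟩
    x            ∎
    where open ≡-Reasoning

  ≤-antisym : ∀ {x y} → x ≤ y → y ≤ x → x ≡ y
  ≤-antisym {x} {y} x≤y y≤x = trans (sym x≤y) (trans (∧-comm x y) y≤x)

  x∧y≤y : ∀ x y → (x ∧ y) ≤ y
  x∧y≤y x y = trans (∧-assoc x y y) (cong (x ∧_) (∧-idem y))

  ⊙-commutativeSemigroup : CommutativeSemigroup a a
  ⊙-commutativeSemigroup = record
    { _∙_ = _⊙_
    ; isCommutativeSemigroup = record
      { isSemigroup = record
        { isMagma = record { isEquivalence = isEquivalence ; ∙-cong = cong₂ _⊙_ }
        ; assoc = ⊙-assoc
        }
      ; comm = ⊙-comm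
      }
    }

  open import Algebra.Properties.CommutativeSemigroup ⊙-commutativeSemigroup
    using () renaming (interchange to ⊙-interchange) public

  ⊙-identityˡ : ∀ x → 𝟙 ⊙ x ≡ x
  ⊙-identityˡ x = trans (⊙-comm 𝟙 x) (⊙-identityʳ x)

  x⊙[x⇒y]≤y : ∀ x y → (x ⊙ (x ⇒ y)) ≤ y
  x⊙[x⇒y]≤y x y = subst (_≤ y) (divisibility x y) (x∧y≤y x y)

  x⇒x≡𝟙 : ∀ x → x ⇒ x ≡ 𝟙
  x⇒x≡𝟙 x = ≤-antisym (𝟙-greatest (x ⇒ x))
    (residuation₂ x x 𝟙 (subst (_≤ x) (sym (⊙-identityʳ x)) (≤-refl x)))

  x⊙y≤y : ∀ x y → (x ⊙ y) ≤ y
  x⊙y≤y x y = subst (_≤ y) (⊙-comm y x)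
    (residuation₁ y y x (subst (x ≤_) (sym (x⇒x≡𝟙 y)) (𝟙-greatest x)))

  x⊙y≤x : ∀ x y → (x ⊙ y) ≤ x
  x⊙y≤x x y = subst (_≤ x) (⊙-comm y x) (x⊙y≤y y x)

  ⊙-monoʳ-≤ : ∀ z {x y} → x ≤ y → (z ⊙ x) ≤ (z ⊙ y)
  ⊙-monoʳ-≤ z {x} {y} x≤y =
    residuation₁ z (z ⊙ y) x (≤-trans x≤y (residuation₂ z (z ⊙ y) y (≤-refl (z ⊙ y))))

  ⊙-mono-≤ : ∀ {x y u v} → x ≤ y → u ≤ v → (x ⊙ u) ≤ (y ⊙ v)
  ⊙-mono-≤ {x} {y} {u} {v} x≤y u≤v = ≤-trans
    (subst₂ _≤_ (⊙-comm u x) (⊙-comm u y) (⊙-monoʳ-≤ u x≤y))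
    (⊙-monoʳ-≤ y u≤v)

  ⇒-monoʳ-≤ : ∀ z {x y} → x ≤ y → (z ⇒ x) ≤ (z ⇒ y)
  ⇒-monoʳ-≤ z {x} {y} x≤y = residuation₂ z y (z ⇒ x) (≤-trans (x⊙[x⇒y]≤y z x) x≤y)

  y≤𝟙⇒y : ∀ y → y ≤ (𝟙 ⇒ y)
  y≤𝟙⇒y y = residuation₂ 𝟙 y y (subst (_≤ y) (sym (⊙-identityˡ y)) (≤-refl y))

  𝟙⇒y≤y : ∀ y → (𝟙 ⇒ y) ≤ y
  𝟙⇒y≤y y = subst (_≤ y) (⊙-identityˡ (𝟙 ⇒ y)) (x⊙[x⇒y]≤y 𝟙 y)

  ^-distribˡ-+-⊙ : ∀ x m n → x ^ (m + n) ≡ x ^ m ⊙ x ^ n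
  ^-distribˡ-+-⊙ x zero     n = sym (⊙-identityˡ (x ^ n))
  ^-distribˡ-+-⊙ x (sucℕ m) n = trans (cong (x ⊙_) (^-distribˡ-+-⊙ x m n)) (sym (⊙-assoc x (x ^ m) (x ^ n)))

  [x⇒y]⊙[u⇒v]≤xu⇒yv : ∀ x y u v → ((x ⇒ y) ⊙ (u ⇒ v)) ≤ (x ⊙ u ⇒ y ⊙ v)
  [x⇒y]⊙[u⇒v]≤xu⇒yv x y u v = residuation₂ (x ⊙ u) (y ⊙ v) ((x ⇒ y) ⊙ (u ⇒ v))
    (subst (_≤ (y ⊙ v)) (sym (⊙-interchange x u (x ⇒ y) (u ⇒ v)))
      (⊙-mono-≤ (x⊙[x⇒y]≤y x y) (x⊙[x⇒y]≤y u v)))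

module FilterProperties {a ℓ : Level} (A : BLAlgebra a) {F : Subset A ℓ} (isFilter : IsFilter A F) where
  open BLAlgebra A
  open BLProperties A
  open IsFilter isFilter

  𝟙∈F : F 𝟙
  𝟙∈F = up-closed (proj₂ nonempty) (𝟙-greatest (proj₁ nonempty))

  modus-ponens : ∀ {x y} → F x → F (x ⇒ y) → F y
  modus-ponens {x} {y} x∈F x⇒y∈F = up-closed (⊙-closed x∈F x⇒y∈F) (x⊙[x⇒y]≤y x y)

  ^-closed : ∀ {x} → F x → ∀ n → F (x ^ n)
  ^-closed x∈F zero     = 𝟙∈F
  ^-closed x∈F (sucℕ n) = ⊙-closed x∈F (^-closed x∈F n)

  ≤[F]-up-closed : ∀ {x y} → _≤[_]_ A x F y → F x → F y
  ≤[F]-up-closed {x} {y} x≤[F]y x∈F =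
    up-closed (modus-ponens x∈F (up-closed x≤[F]y (x⊙y≤y _ _))) (x∧y≤y x y)

  proper⇒𝟘∉F : IsProper A F → ¬ F 𝟘
  proper⇒𝟘∉F (x , x∉F) 𝟘∈F = x∉F (up-closed 𝟘∈F (𝟘-least x))

module StateOperatorProperties {a : Level} (A : BLAlgebra a) {σ : BLAlgebra.Carrier A → BLAlgebra.Carrier A}
                               (isStateOperator : IsStateOperator A σ) where
  open BLAlgebra A
  open BLProperties A
  open IsStateOperator isStateOperator

  σ-mono-≤ : ∀ {x y} → x ≤ y → σ x ≤ σ y
  σ-mono-≤ {x} {y} x≤y = subst (_≤ σ y) (sym σx≡σy⊙σ[y⇒x]) (x⊙y≤x (σ y) _)
    where
    y⊙[y⇒x]≡x : y ⊙ (y ⇒ x) ≡ x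
    y⊙[y⇒x]≡x = trans (sym (divisibility y x)) (trans (∧-comm y x) x≤y)
    σx≡σy⊙σ[y⇒x] : σ x ≡ σ y ⊙ σ (y ⇒ x)
    σx≡σy⊙σ[y⇒x] = begin
      σ x                         ≡⟨ cong σ (sym y⊙[y⇒x]≡x) ⟩
      σ (y ⊙ (y ⇒ x))             ≡⟨ σ-⊙ y (y ⇒ x) ⟩
      σ y ⊙ σ (y ⇒ y ⊙ (y ⇒ x))   ≡⟨ cong (λ t → σ y ⊙ σ (y ⇒ t)) y⊙[y⇒x]≡x ⟩
      σ y ⊙ σ (y ⇒ x)             ∎
      where open ≡-Reasoning

  σ-𝟙 : σ 𝟙 ≡ 𝟙
  σ-𝟙 = begin
    σ 𝟙                ≡⟨ cong σ (sym (x⇒x≡𝟙 𝟙)) ⟩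
    σ (𝟙 ⇒ 𝟙)          ≡⟨ σ-⇒ 𝟙 𝟙 ⟩
    σ 𝟙 ⇒ σ (𝟙 ∧ 𝟙)    ≡⟨ cong (λ t → σ 𝟙 ⇒ σ t) (∧-idem 𝟙) ⟩
    σ 𝟙 ⇒ σ 𝟙          ≡⟨ x⇒x≡𝟙 (σ 𝟙) ⟩
    𝟙                  ∎
    where open ≡-Reasoning

  σ-idem : ∀ x → σ (σ x) ≡ σ x
  σ-idem x = trans (cong σ (sym σx⊙σ𝟙≡σx)) (trans (σ-σ⊙ x 𝟙) σx⊙σ𝟙≡σx)
    where
    σx⊙σ𝟙≡σx : σ x ⊙ σ 𝟙 ≡ σ x
    σx⊙σ𝟙≡σx = trans (cong (σ x ⊙_) σ-𝟙) (⊙-identityʳ (σ x))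

  σ-fixed-^ : ∀ {s} → σ s ≡ s → ∀ n → σ (s ^ n) ≡ s ^ n
  σ-fixed-^ σs≡s zero = σ-𝟙
  σ-fixed-^ {s} σs≡s (sucℕ n) = begin
    σ (s ⊙ s ^ n)          ≡⟨ cong₂ (λ u v → σ (u ⊙ v)) (sym σs≡s) (sym σsⁿ≡sⁿ) ⟩
    σ (σ s ⊙ σ (s ^ n))    ≡⟨ σ-σ⊙ s (s ^ n) ⟩
    σ s ⊙ σ (s ^ n)        ≡⟨ cong₂ _⊙_ σs≡s σsⁿ≡sⁿ ⟩
    s ⊙ s ^ n              ∎
    where
    open ≡-Reasoning
    σsⁿ≡sⁿ : σ (s ^ n) ≡ s ^ n
    σsⁿ≡sⁿ = σ-fixed-^ σs≡s n

  σ-fixed-⇒-≤ : ∀ {s} → σ s ≡ s → ∀ y → σ (s ⇒ y) ≤ (s ⇒ σ y)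
  σ-fixed-⇒-≤ {s} σs≡s y =
    subst (_≤ (s ⇒ σ y)) (sym (trans (σ-⇒ s y) (cong (_⇒ σ (s ∧ y)) σs≡s)))
      (⇒-monoʳ-≤ s (σ-mono-≤ (x∧y≤y s y)))

module Adjoin {a ℓ : Level} (A : BLAlgebra a) where
  open BLAlgebra A
  open BLProperties A

  ⟨_,_⟩ : Subset A ℓ → Carrier → Subset A ℓ
  ⟨ F , s ⟩ y = ∃ λ n → F (s ^ n ⇒ y)

  module _ {F : Subset A ℓ} (isFilter : IsFilter A F) (s : Carrier) where
    open IsFilter isFilter
    open FilterProperties A isFilter

    F⊆⟨F,s⟩ : ∀ {y} → F y → ⟨ F , s ⟩ y
    F⊆⟨F,s⟩ {y} y∈F = 0 , up-closed y∈F (y≤𝟙⇒y y)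

    s∈⟨F,s⟩ : ⟨ F , s ⟩ s
    s∈⟨F,s⟩ = 1 , subst F (sym (trans (cong (_⇒ s) (⊙-identityʳ s)) (x⇒x≡𝟙 s))) 𝟙∈F

    ⟨F,s⟩-⊙-closed : ∀ {y z} → ⟨ F , s ⟩ y → ⟨ F , s ⟩ z → ⟨ F , s ⟩ (y ⊙ z)
    ⟨F,s⟩-⊙-closed {y} {z} (m , p) (n , q) = m + n , up-closed (⊙-closed p q)
      (subst (λ t → ((s ^ m ⇒ y) ⊙ (s ^ n ⇒ z)) ≤ (t ⇒ y ⊙ z)) (sym (^-distribˡ-+-⊙ s m n))
        ([x⇒y]⊙[u⇒v]≤xu⇒yv (s ^ m) y (s ^ n) z))

    ⟨F,s⟩-isFilter : IsFilter A ⟨ F , s ⟩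
    ⟨F,s⟩-isFilter = record
      { nonempty  = 𝟙 , F⊆⟨F,s⟩ 𝟙∈F
      ; ⊙-closed  = ⟨F,s⟩-⊙-closed
      ; up-closed = λ (n , p) y≤z → n , up-closed p (⇒-monoʳ-≤ (s ^ n) y≤z)
      }

    ⟨F,s⟩-proper : ¬ F 𝟘 → CoInfinitesimalMod A F s → IsProper A ⟨ F , s ⟩
    ⟨F,s⟩-proper 𝟘∉F s-coinf = 𝟘 , λ
      { (zero , p)   → 𝟘∉F (up-closed p (𝟙⇒y≤y 𝟘))
      ; (sucℕ n , p) → 𝟘∉F (modus-ponens (^-closed (≤[F]-up-closed (s-coinf n) p) (sucℕ n)) p)
      }

    module _ {σ : Carrier → Carrier} (isStateOperator : IsStateOperator A σ)
             (σ-closed : ∀ {y} → F y → F (σ y)) (σs≡s : σ s ≡ s) where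
      open StateOperatorProperties A isStateOperator

      ⟨F,s⟩-isStateFilter : IsStateFilter A σ ⟨ F , s ⟩
      ⟨F,s⟩-isStateFilter = record
        { isFilter = ⟨F,s⟩-isFilter
        ; σ-closed = λ { {y} (n , p) → n , up-closed (σ-closed p) (σ-fixed-⇒-≤ (σ-fixed-^ σs≡s n) y) }
        }

proposition5p7 : ∀ {a ℓ : Level} (A : BLAlgebra a) (σ : BLAlgebra.Carrier A → BLAlgebra.Carrier A) →
    IsStateOperator A σ → (F : Subset A ℓ) → IsMaximalStateFilter A σ F →
    (x : BLAlgebra.Carrier A) → CoInfinitesimalMod A F (σ x) → F (σ x)
proposition5p7 {ℓ = ℓ} A σ isStateOperator F isMaximal x σx-coinf =
  maximal ⟨ F , σ x ⟩ ⟨F,σx⟩-isStateFilter ⟨F,σx⟩-proper (F⊆⟨F,s⟩ isFilter (σ x)) (s∈⟨F,s⟩ isFilter (σ x))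
  where
  open IsMaximalStateFilter isMaximal
  open IsStateFilter isStateFilter
  open Adjoin {ℓ = ℓ} A
  open StateOperatorProperties A isStateOperator using (σ-idem)

  ⟨F,σx⟩-isStateFilter : IsStateFilter A σ ⟨ F , σ x ⟩
  ⟨F,σx⟩-isStateFilter = ⟨F,s⟩-isStateFilter isFilter (σ x) isStateOperator σ-closed (σ-idem x)

  ⟨F,σx⟩-proper : IsProper A ⟨ F , σ x ⟩
  ⟨F,σx⟩-proper = ⟨F,s⟩-proper isFilter (σ x) (FilterProperties.proper⇒𝟘∉F A isFilter proper) σx-coinf
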